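{- Let $k\in\mathbb{N}$ and let $G_c=(V_c,E_c)$ be a connected simple undirected graph with vertices $V_c=\{v_1,\dots,v_{n_c}\}$. Construct the gadget graph $G_g=(V_g,E_g)$ by replacing every edge of $G_c$ by a path of length $3$ (with two new interior vertices) and, for every pair of distinct non-adjacent vertices of $G_c$, adding a path of length $2$ between them (with one new interior vertex), all new vertices being distinct and enumerated so that $V_g=\{v_1,\dots,v_{n_c},v_{n_c+1},\dots,v_{n_g}\}$. Let $n=n_g+1$ and define the $n\times n$ matrix $D$ by $D_{ij}=d_{G_g}(v_i,v_j)$ for $i,j\in[n_g]$, $D_{in}=D_{ni}=2$ for $i\in[n_c]$, $D_{in}=D_{ni}=3$ for $i\in[n_g]\setminus[n_c]$, and $D_{nn}=0$. If $D$ is a YES-instance of $k$-\textsc{CombDMR}, then $G_c$ is $k$-colourable.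
   Context: $[n]=\{1,\dots,n\}$; $d_{G_g}$ is the shortest-path distance in $G_g$. A graph is $k$-colourable if there is a map $\chi$ from its vertices to $[k]$ giving different values to the endpoints of every edge. For an $n\times n$ matrix $D$ with non-negative integer entries, a graph realisation is a pair $(G,\Phi)$ with $G=(V,E)$ a finite simple undirected unweighted graph and $\Phi:[n]\to V$ injective such that $d_G(\Phi(i),\Phi(j))=D_{ij}$ for all $i,j$; $D$ is a YES-instance of $k$-\textsc{CombDMR} if it has a graph realisation with $|V|\le n+k$. -}

module Defs where

open import Data.Nat using (ℕ; zero; suc; _+_; _<_; _≤_)
open import Data.Fin using (Fin; inject₁; fromℕ; _↑ˡ_; _↑ʳ_)
import Data.Fin as F
open import Data.Bool using (Bool; true; false)
open import Data.Product using (Σ; ∃; ∃-syntax; _×_; _,_)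
open import Data.Sum using (_⊎_)
open import Relation.Binary.PropositionalEquality using (_≡_; _≢_)
open import Relation.Nullary using (¬_)
open import Function.Bundles using (_⤖_; Bijection)
open import Function.Definitions using (Injective)

record SimpleGraph (n : ℕ) : Set where
  field
    adj        : Fin n → Fin n → Bool
    adj-sym    : ∀ u v → adj u v ≡ adj v u
    adj-irrefl : ∀ u → adj u u ≡ false

open SimpleGraph public

Edge : {n : ℕ} → SimpleGraph n → Fin n → Fin n → Set
Edge G u v = adj G u v ≡ true

data Walk {V : Set} (E : V → V → Set) : V → V → ℕ → Set where
  here  : ∀ {u} → Walk E u u 0
  step  : ∀ {u w v ℓ} → E u w → Walk E w v ℓ → Walk E u v (suc ℓ)

Dist : {V : Set} → (V → V → Set) → V → V → ℕ → Set
Dist E u v d = Walk E u v d × (∀ ℓ → ℓ < d → ¬ Walk E u v ℓ)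

Connected : {n : ℕ} → SimpleGraph n → Set
Connected G = ∀ u v → ∃[ ℓ ] Walk (Edge G) u v ℓ

Colourable : ℕ → {n : ℕ} → SimpleGraph n → Set
Colourable k {n} G =
  Σ (Fin n → Fin k) λ χ → ∀ u v → Edge G u v → χ u ≢ χ v

record Realisation (n : ℕ) (D : Fin n → Fin n → ℕ) (m : ℕ) : Set where
  field
    graph   : SimpleGraph m
    Φ       : Fin n → Fin m
    Φ-inj   : Injective _≡_ _≡_ Φ
    Φ-dist  : ∀ i j → Dist (Edge graph) (Φ i) (Φ j) (D i j)

CombDMR-YES : (k : ℕ) {n : ℕ} → (Fin n → Fin n → ℕ) → Set
CombDMR-YES k {n} D = ∃[ m ] (m ≤ n + k × Realisation n D m)

-- Each unordered pair {i,j} of distinct vertices is represented once,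
-- by i < j.  An edge i-j of G_c becomes the path
--   orig i — edgeL i j — edgeR i j — orig j   (length 3),
-- a non-adjacent pair becomes the path
--   orig i — mid i j — orig j                 (length 2).

module Gadget {nc : ℕ} (Gc : SimpleGraph nc) where

  data GV : Set where
    orig  : Fin nc → GV
    edgeL : (i j : Fin nc) → i F.< j → adj Gc i j ≡ true  → GV
    edgeR : (i j : Fin nc) → i F.< j → adj Gc i j ≡ true  → GV
    mid   : (i j : Fin nc) → i F.< j → adj Gc i j ≡ false → GV

  -- one orientation of each gadget edge
  data GE : GV → GV → Set where
    e-origL  : ∀ i j p a → GE (orig i) (edgeL i j p a)
    e-LR     : ∀ i j p a → GE (edgeL i j p a) (edgeR i j p a)
    e-Rorig  : ∀ i j p a → GE (edgeR i j p a) (orig j)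
    e-origM  : ∀ i j p a → GE (orig i) (mid i j p a)
    e-Morig  : ∀ i j p a → GE (mid i j p a) (orig j)

  GEdge : GV → GV → Set
  GEdge x y = GE x y ⊎ GE y x

-- The matrix D built from G_c, relative to an enumeration
-- e : Fin (nc + r) ⤖ V_g whose first nc entries are v_1,…,v_nc.
-- Here ng = nc + r, n = ng + 1, and the last index (fromℕ ng) is n.
module _ {nc : ℕ} (Gc : SimpleGraph nc) where
  open Gadget Gc

  IsGadgetMatrix : (r : ℕ) → (Fin (nc + r) ⤖ GV)
                 → (Fin (suc (nc + r)) → Fin (suc (nc + r)) → ℕ) → Set
  IsGadgetMatrix r e D =
      (∀ i j → Dist GEdge (Bijection.to e i) (Bijection.to e j)
                          (D (inject₁ i) (inject₁ j)))
    × (∀ (i : Fin nc) → D (inject₁ (i ↑ˡ r)) (fromℕ (nc + r)) ≡ 2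
                      × D (fromℕ (nc + r)) (inject₁ (i ↑ˡ r)) ≡ 2)
    × (∀ (i : Fin r) → D (inject₁ (nc ↑ʳ i)) (fromℕ (nc + r)) ≡ 3
                     × D (fromℕ (nc + r)) (inject₁ (nc ↑ʳ i)) ≡ 3)
    × D (fromℕ (nc + r)) (fromℕ (nc + r)) ≡ 0

{-# OPTIONS --safe #-}
-- Let x be the image of the extra index n. Each original vertex vᵢ is at
-- distance 2 from x, so Φ(vᵢ) and x have a common neighbour hᵢ; and since no
-- entry of the last column of D equals 1, no hᵢ lies in the image of Φ. There
-- are at most k vertices outside that image, so i ↦ hᵢ is a k-colouring: if
-- vᵤ and vᵥ are adjacent in G_c they are at distance 3 in G_g, whereas hᵤ = hᵥ
-- would give a walk of length 2 from Φ(vᵤ) to Φ(vᵥ).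
module Submission where

open import Defs
open import Data.Nat using (ℕ; zero; suc; _+_; _≤_; _<_; s≤s)
open import Data.Nat.Properties using (≤-pred; ≮⇒≥; <⇒≱; ≤∧≢⇒<; n<1⇒n≡0)
open import Data.Fin using (Fin; _↑ˡ_; inject₁; fromℕ; inject≤; punchOut; splitAt; join)
open import Data.Fin.Properties using (0≢1+n; suc-injective; inject≤-injective; punchOut-injective; join-splitAt)
open import Data.Fin.Relation.Unary.Top using (view; ‵fromℕ; ‵inject₁)
open import Data.Bool using (false)
open import Data.Bool.Properties using (not-¬)
open import Data.Product using (Σ; ∃-syntax; _×_; _,_; proj₁; proj₂)
open import Data.Sum using (inj₁; inj₂)
open import Function.Base using (_on_)
open import Function.Bundles using (_⤖_; Bijection)
open import Function.Definitions using (Injective)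
open import Relation.Binary.PropositionalEquality
open import Relation.Nullary using (¬_)

Edge-irrefl : ∀ {n} (G : SimpleGraph n) u → ¬ Edge G u u
Edge-irrefl G u u~u with () ← trans (sym u~u) (adj-irrefl G u)

Edge-sym : ∀ {n} (G : SimpleGraph n) {u v} → Edge G u v → Edge G v u
Edge-sym G {u} {v} u~v = trans (adj-sym G v u) u~v

module _ {V : Set} {E : V → V → Set} where

  Walk₀⇒≡ : ∀ {u v} → Walk E u v 0 → u ≡ v
  Walk₀⇒≡ here = refl

  Walk₂⇒common-neighbour : ∀ {u v} → Walk E u v 2 → ∃[ w ] E u w × E w v
  Walk₂⇒common-neighbour (step u~w (step w~v here)) = _ , u~w , w~v

  Dist⇒≤-Walk : ∀ {u v d ℓ} → Dist E u v d → Walk E u v ℓ → d ≤ ℓ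
  Dist⇒≤-Walk (_ , minimal) walk = ≮⇒≥ λ ℓ<d → minimal _ ℓ<d walk

OutsideImage : {A : Set} {m : ℕ} → (A → Fin m) → Fin m → Set
OutsideImage Φ v = ∀ i → Φ i ≢ v

outside-image-injection : ∀ n {m k} {Φ : Fin n → Fin m} →
  Injective _≡_ _≡_ Φ → m ≤ n + k →
  Σ (Σ (Fin m) (OutsideImage Φ) → Fin k) (Injective (_≡_ on proj₁) _≡_)
outside-image-injection zero _ m≤k =
  (λ (v , _) → inject≤ v m≤k) , inject≤-injective m≤k m≤k _ _
outside-image-injection (suc n) {zero} {Φ = Φ} _ _ with () ← Φ Fin.zero
outside-image-injection (suc n) {suc m} {k} {Φ} Φ-inj m≤ =
  ψ , λ {a b} → ψ-inj {a} {b}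
  where
  Φ₀≢ : ∀ i → Φ Fin.zero ≢ Φ (Fin.suc i)
  Φ₀≢ i eq = 0≢1+n (Φ-inj eq)

  Φ′ : Fin n → Fin m
  Φ′ i = punchOut (Φ₀≢ i)

  Φ′-inj : Injective _≡_ _≡_ Φ′
  Φ′-inj eq = suc-injective (Φ-inj (punchOut-injective (Φ₀≢ _) (Φ₀≢ _) eq))

  IH : Σ (Σ (Fin m) (OutsideImage Φ′) → Fin k) (Injective (_≡_ on proj₁) _≡_)
  IH = outside-image-injection n Φ′-inj (≤-pred m≤)

  punchOut-outside : Σ (Fin (suc m)) (OutsideImage Φ) → Σ (Fin m) (OutsideImage Φ′)
  punchOut-outside (v , v∉) =
    punchOut (v∉ Fin.zero) ,
    λ i eq → v∉ (Fin.suc i) (punchOut-injective (Φ₀≢ i) (v∉ Fin.zero) eq)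

  ψ : Σ (Fin (suc m)) (OutsideImage Φ) → Fin k
  ψ a = proj₁ IH (punchOut-outside a)

  ψ-inj : Injective (_≡_ on proj₁) _≡_ ψ
  ψ-inj {a@(_ , v∉)} {b@(_ , w∉)} eq =
    punchOut-injective (v∉ Fin.zero) (w∉ Fin.zero)
      (proj₂ IH {punchOut-outside a} {punchOut-outside b} eq)

module _ {n m : ℕ} {D : Fin n → Fin n → ℕ} (R : Realisation n D m) where
  open Realisation R

  neighbour-outside-image : ∀ {t w} → (∀ j → D j t ≢ 1) →
                            Edge graph w (Φ t) → OutsideImage Φ w
  neighbour-outside-image {t} D≢1 w~t j refl =
    Edge-irrefl graph (Φ t) (subst (λ x → Edge graph x (Φ t)) Φj≡Φt w~t)
    where
    Djt≡0 : D j t ≡ 0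
    Djt≡0 = n<1⇒n≡0 (≤∧≢⇒< (Dist⇒≤-Walk (Φ-dist j t) (step w~t here)) (D≢1 j))

    Φj≡Φt : Φ j ≡ Φ t
    Φj≡Φt = Walk₀⇒≡ (subst (Walk _ _ _) Djt≡0 (proj₁ (Φ-dist j t)))

  hub-colouring : ∀ {c k} → m ≤ n + k → (t : Fin n) → (∀ j → D j t ≢ 1) →
                  (o : Fin c → Fin n) → (∀ i → D (o i) t ≡ 2) →
                  Σ (Fin c → Fin k) λ χ → ∀ u v → χ u ≡ χ v → D (o u) (o v) ≤ 2
  hub-colouring {c} {k} m≤ t D≢1 o D≡2 = χ , λ u v χu≡χv →
    Dist⇒≤-Walk (Φ-dist (o u) (o v)) (walk-via-hub u v (proj₂ ψ χu≡χv))
    where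
    ψ : Σ (Σ (Fin m) (OutsideImage Φ) → Fin k) (Injective (_≡_ on proj₁) _≡_)
    ψ = outside-image-injection n Φ-inj m≤

    common-neighbour : ∀ i → ∃[ h ] Edge graph (Φ (o i)) h × Edge graph h (Φ t)
    common-neighbour i =
      Walk₂⇒common-neighbour (subst (Walk _ _ _) (D≡2 i) (proj₁ (Φ-dist (o i) t)))

    hub : Fin c → Fin m
    hub i = proj₁ (common-neighbour i)

    o~hub : ∀ i → Edge graph (Φ (o i)) (hub i)
    o~hub i = proj₁ (proj₂ (common-neighbour i))

    hub~t : ∀ i → Edge graph (hub i) (Φ t)
    hub~t i = proj₂ (proj₂ (common-neighbour i))

    χ : Fin c → Fin k
    χ i = proj₁ ψ (hub i , neighbour-outside-image D≢1 (hub~t i))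

    walk-via-hub : ∀ u v → hub u ≡ hub v → Walk (Edge graph) (Φ (o u)) (Φ (o v)) 2
    walk-via-hub u v same =
      step (o~hub u) (step hub-u~v here)
      where
      hub-u~v : Edge graph (hub u) (Φ (o v))
      hub-u~v = subst (λ h → Edge graph h (Φ (o v))) (sym same) (Edge-sym graph (o~hub v))

module _ {nc : ℕ} (Gc : SimpleGraph nc) where
  open Gadget Gc

  Walk<3⇒non-adjacent : ∀ {i j d} → Walk GEdge (orig i) (orig j) d → d < 3 →
                        adj Gc i j ≡ false
  Walk<3⇒non-adjacent {i} here _ = adj-irrefl Gc i
  Walk<3⇒non-adjacent (step (inj₁ ()) here) _
  Walk<3⇒non-adjacent (step (inj₂ ()) here) _
  Walk<3⇒non-adjacent {i} (step (inj₁ (e-origL _ _ _ _)) (step (inj₂ (e-origL _ _ _ _)) here)) _ =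
    adj-irrefl Gc i
  Walk<3⇒non-adjacent {i} (step (inj₂ (e-Rorig _ _ _ _)) (step (inj₁ (e-Rorig _ _ _ _)) here)) _ =
    adj-irrefl Gc i
  Walk<3⇒non-adjacent {i} (step (inj₁ (e-origM _ _ _ _)) (step (inj₂ (e-origM _ _ _ _)) here)) _ =
    adj-irrefl Gc i
  Walk<3⇒non-adjacent {i} (step (inj₂ (e-Morig _ _ _ _)) (step (inj₁ (e-Morig _ _ _ _)) here)) _ =
    adj-irrefl Gc i
  Walk<3⇒non-adjacent (step (inj₁ (e-origM _ _ _ i≁j)) (step (inj₁ (e-Morig _ _ _ _)) here)) _ =
    i≁j
  Walk<3⇒non-adjacent {i} {j} (step (inj₂ (e-Morig _ _ _ j≁i)) (step (inj₂ (e-origM _ _ _ _)) here)) _ =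
    trans (adj-sym Gc i j) j≁i
  Walk<3⇒non-adjacent (step _ (step _ (step _ _))) (s≤s (s≤s (s≤s ())))

  adjacent⇒3≤Walk : ∀ {i j d} → Edge Gc i j → Walk GEdge (orig i) (orig j) d → 3 ≤ d
  adjacent⇒3≤Walk i~j walk = ≮⇒≥ λ d<3 → not-¬ i~j (Walk<3⇒non-adjacent walk d<3)

module _ {nc r : ℕ} {Gc : SimpleGraph nc} (e : Fin (nc + r) ⤖ Gadget.GV Gc)
         (D : Fin (suc (nc + r)) → Fin (suc (nc + r)) → ℕ) where
  open Gadget Gc

  gadget-last-column≢1 : IsGadgetMatrix Gc r e D → ∀ j → D j (fromℕ (nc + r)) ≢ 1
  gadget-last-column≢1 (_ , _ , _ , corner) j with view j
  ... | ‵fromℕ = subst (_≢ 1) (sym corner) λ ()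
  gadget-last-column≢1 (_ , col-orig , col-new , _) _ | ‵inject₁ j =
    subst (λ j → D (inject₁ j) (fromℕ (nc + r)) ≢ 1) (join-splitAt nc r j) (by-block (splitAt nc j))
    where
    by-block : ∀ s → D (inject₁ (join nc r s)) (fromℕ (nc + r)) ≢ 1
    by-block (inj₁ i) = subst (_≢ 1) (sym (proj₁ (col-orig i))) λ ()
    by-block (inj₂ i) = subst (_≢ 1) (sym (proj₁ (col-new i))) λ ()

  gadget-adjacent⇒3≤D : (∀ i → Bijection.to e (i ↑ˡ r) ≡ orig i) → IsGadgetMatrix Gc r e D →
                        ∀ {u v} → Edge Gc u v → 3 ≤ D (inject₁ (u ↑ˡ r)) (inject₁ (v ↑ˡ r))
  gadget-adjacent⇒3≤D e-orig (dist , _) {u} {v} u~v =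
    adjacent⇒3≤Walk Gc u~v
      (subst₂ (λ x y → Walk GEdge x y _) (e-orig u) (e-orig v) (proj₁ (dist (u ↑ˡ r) (v ↑ˡ r))))

proposition15 : (k nc : ℕ) (Gc : SimpleGraph nc) → Connected Gc
    → (r : ℕ) (e : Fin (nc + r) ⤖ Gadget.GV Gc)
    → (∀ (i : Fin nc) → Bijection.to e (i ↑ˡ r) ≡ Gadget.orig i)
    → (D : Fin (suc (nc + r)) → Fin (suc (nc + r)) → ℕ)
    → IsGadgetMatrix Gc r e D
    → CombDMR-YES k D
    → Colourable k Gc
proposition15 k nc Gc _ r e e-orig D isGM (m , m≤ , R) =
  χ , λ u v u~v χu≡χv → <⇒≱ (gadget-adjacent⇒3≤D e D e-orig isGM u~v) (proj₂ colouring u v χu≡χv)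
  where
  orig-index : Fin nc → Fin (suc (nc + r))
  orig-index i = inject₁ (i ↑ˡ r)

  orig-index-to-last≡2 : ∀ i → D (orig-index i) (fromℕ (nc + r)) ≡ 2
  orig-index-to-last≡2 i = proj₁ (proj₁ (proj₂ isGM) i)

  colouring : Σ (Fin nc → Fin k) λ χ → ∀ u v → χ u ≡ χ v → D (orig-index u) (orig-index v) ≤ 2
  colouring = hub-colouring R m≤ (fromℕ (nc + r)) (gadget-last-column≢1 e D isGM)
                orig-index orig-index-to-last≡2

  χ : Fin nc → Fin k
  χ = proj₁ colouring
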